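{- Let $n\ge 1$ and let ${\cal ORCT}_n$ be the set of full contractions of $X_n=\{1,\dots,n\}$ that are order-preserving or order-reversing. For integers $1\le p\le k\le n$, let $F(n;p,k)$ be the number of $\alpha\in{\cal ORCT}_n$ with $h(\alpha)=p$ and $w^+(\alpha)=k$. Then $F(n;p,k)=2\binom{n-1}{p-1}$ if $p>1$, and $F(n;p,k)=1$ if $p=1$.
   Context: $X_n=\{1,\dots,n\}$ with its usual order; full transformations are maps $\alpha:X_n\to X_n$, written $x\mapsto x\alpha$. $\alpha$ is order-preserving if $x\le y\Rightarrow x\alpha\le y\alpha$, order-reversing if $x\le y\Rightarrow x\alpha\ge y\alpha$, and a contraction if $|x\alpha-y\alpha|\le|x-y|$ for all $x,y$. ${\cal ORCT}_n$ is the set of contractions that are order-preserving or order-reversing. $h(\alpha)=|\mathrm{Im}\,\alpha|$, $w^+(\alpha)=\max(\mathrm{Im}\,\alpha)$. -}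

module Defs where

open import Data.Nat using (ℕ; zero; suc; _≤_; _+_; _∸_)
open import Data.Nat.Properties using (_≤?_)
open import Data.Fin using (Fin; toℕ)
open import Data.Fin.Properties using (any?; all?)
open import Data.List using (List; []; _∷_; map; concatMap; filter; length; allFin)
open import Data.Product using (∃; _×_; _,_)
open import Data.Sum using (_⊎_)
open import Relation.Binary.PropositionalEquality using (_≡_)
open import Relation.Nullary using (Dec; yes; no)
open import Relation.Nullary.Decidable using (_×-dec_; _⊎-dec_; _→-dec_)
open import Data.Nat using (_≟_)

-- X_n = {1,…,n} is modelled by Fin n (element i stands for toℕ i + 1);
-- the shift by one preserves the order and all distances |x - y|.
X : ℕ → Set
X n = Fin n

Transf : ℕ → Set
Transf n = X n → X n

dist : ℕ → ℕ → ℕ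
dist a b = (a ∸ b) + (b ∸ a)

IsOrderPreserving : ∀ {n} → Transf n → Set
IsOrderPreserving {n} α = (x y : X n) → toℕ x ≤ toℕ y → toℕ (α x) ≤ toℕ (α y)

IsOrderReversing : ∀ {n} → Transf n → Set
IsOrderReversing {n} α = (x y : X n) → toℕ x ≤ toℕ y → toℕ (α y) ≤ toℕ (α x)

IsContraction : ∀ {n} → Transf n → Set
IsContraction {n} α = (x y : X n) → dist (toℕ (α x)) (toℕ (α y)) ≤ dist (toℕ x) (toℕ y)

InORCT : ∀ {n} → Transf n → Set
InORCT α = IsContraction α × (IsOrderPreserving α ⊎ IsOrderReversing α)

InImage : ∀ {n} → Transf n → X n → Set
InImage {n} α y = ∃ λ (x : X n) → α x ≡ y

inImage? : ∀ {n} (α : Transf n) (y : X n) → Dec (InImage α y)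
inImage? α y = any? (λ x → Data.Fin._≟_ (α x) y)

h : ∀ {n} → Transf n → ℕ
h {n} α = length (filter (inImage? α) (allFin n))

-- w⁺(α) = max (Im α) = k, in the 1-based numbering of X_n:
-- some image point has value k and every image point has value ≤ k.
HasMaxImage : ∀ {n} → Transf n → ℕ → Set
HasMaxImage {n} α k = (∃ λ (x : X n) → suc (toℕ (α x)) ≡ k) × ((x : X n) → suc (toℕ (α x)) ≤ k)

isOP? : ∀ {n} (α : Transf n) → Dec (IsOrderPreserving α)
isOP? α = all? λ x → all? λ y → (toℕ x ≤? toℕ y) →-dec (toℕ (α x) ≤? toℕ (α y))

isOR? : ∀ {n} (α : Transf n) → Dec (IsOrderReversing α)
isOR? α = all? λ x → all? λ y → (toℕ x ≤? toℕ y) →-dec (toℕ (α y) ≤? toℕ (α x))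

isContr? : ∀ {n} (α : Transf n) → Dec (IsContraction α)
isContr? α = all? λ x → all? λ y →
  dist (toℕ (α x)) (toℕ (α y)) ≤? dist (toℕ x) (toℕ y)

inORCT? : ∀ {n} (α : Transf n) → Dec (InORCT α)
inORCT? α = isContr? α ×-dec (isOP? α ⊎-dec isOR? α)

hasMaxImage? : ∀ {n} (α : Transf n) (k : ℕ) → Dec (HasMaxImage α k)
hasMaxImage? α k = any? (λ x → suc (toℕ (α x)) ≟ k) ×-dec all? (λ x → suc (toℕ (α x)) ≤? k)

-- explicit enumeration of all maps Fin m → Fin n (each exactly once)
allMaps : (m n : ℕ) → List (Fin m → Fin n)
allMaps zero    n = (λ ()) ∷ []
allMaps (suc m) n = concatMap (λ (a : Fin n) → map (λ f → extend a f) (allMaps m n)) (allFin n)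
  where
  extend : Fin n → (Fin m → Fin n) → Fin (suc m) → Fin n
  extend a f Fin.zero    = a
  extend a f (Fin.suc i) = f i

Counted : (n p k : ℕ) → Transf n → Set
Counted n p k α = InORCT α × (h α ≡ p) × HasMaxImage α k

counted? : (n p k : ℕ) (α : Transf n) → Dec (Counted n p k α)
counted? n p k α = inORCT? α ×-dec ((h α ≟ p) ×-dec hasMaxImage? α k)

F : ℕ → ℕ → ℕ → ℕ
F n p k = length (filter (counted? n p k) (allMaps n n))

module Submission where

-- Write n = m + 1 and read a transformation α of X_n through its sequence of
-- values v = toℕ ∘ α (0-based).  An order-preserving contraction moves in
-- steps of 0 or +1, i.e. v is a *walk* from v 0 to its maximum; its image is
-- the whole interval [v 0, max].  An order-reversing contraction becomes one
-- after *mirroring* its values, v ↦ m ∸ v.  Hence (with p = p′ + 1 and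
-- k = k′ + 1) α is counted by F(n; p, k) exactly when v is a walk from
-- k′ ∸ p′ up to k′, or its mirror is a walk from m ∸ k′ up to m ∸ (k′ ∸ p′).
-- Walks from s to t of length m + 1 number m C (t ∸ s): choose which steps go
-- up.  For p > 1 the two shapes are disjoint, giving 2 · (m C p′); for p = 1
-- both are the same constant map, giving 1.

open import Defs
open import Data.Nat using (ℕ; zero; suc; _+_; _*_; _∸_; _≤_; _<_; z≤n; s≤s; s≤s⁻¹; _<?_; _≤?_; _≟_)
open import Data.Nat.Properties
open import Data.Nat.Combinatorics using (_C_; nCk+nC[k+1]≡[n+1]C[k+1])
open import Data.Fin as Fin using (Fin; toℕ; fromℕ<) renaming (zero to fzero; suc to fsuc)
open import Data.Fin.Properties using (toℕ-injective; toℕ-fromℕ<; toℕ<n; toℕ≤pred[n])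
open import Data.Vec.Functional using (tail)
open import Data.List using (List; []; _∷_; map; concatMap; filter; length; _++_; allFin; tabulate)
open import Data.List.Properties using (filter-≐; filter-++; length-++; map-tabulate)
open import Data.Product using (∃; ∃₂; _×_; _,_; proj₁; proj₂)
open import Data.Sum using (_⊎_; inj₁; inj₂)
open import Function using (_∘_; id)
open import Relation.Binary.PropositionalEquality
open import Relation.Nullary using (Dec; yes; no; ¬_; contradiction)
open import Relation.Nullary.Decidable using (_×-dec_; _⊎-dec_)
open import Relation.Unary using (Pred; Decidable; _≐_)
open import Level using (0ℓ)

count : {A : Set} {P : Pred A 0ℓ} → Decidable P → List A → ℕ
count P? xs = length (filter P? xs)

module _ {A : Set} where

  count-≐ : {P Q : Pred A 0ℓ} (P? : Decidable P) (Q? : Decidable Q) →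
            P ≐ Q → (xs : List A) → count P? xs ≡ count Q? xs
  count-≐ P? Q? P≐Q xs = cong length (filter-≐ P? Q? P≐Q xs)

  count-none : {P : Pred A 0ℓ} (P? : Decidable P) → (∀ x → ¬ P x) →
               (xs : List A) → count P? xs ≡ 0
  count-none P? ¬P []       = refl
  count-none P? ¬P (x ∷ xs) with P? x
  ... | yes p = contradiction p (¬P x)
  ... | no  _ = count-none P? ¬P xs

  count-all : {P : Pred A 0ℓ} (P? : Decidable P) → (∀ x → P x) →
              (xs : List A) → count P? xs ≡ length xs
  count-all P? all-P []       = refl
  count-all P? all-P (x ∷ xs) with P? x
  ... | yes _  = cong suc (count-all P? all-P xs)
  ... | no ¬px = contradiction (all-P x) ¬px

  count-⊎ : {P Q : Pred A 0ℓ} (P? : Decidable P) (Q? : Decidable Q) →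
            (∀ x → P x → ¬ Q x) → (xs : List A) →
            count (λ x → P? x ⊎-dec Q? x) xs ≡ count P? xs + count Q? xs
  count-⊎ P? Q? disjoint []       = refl
  count-⊎ P? Q? disjoint (x ∷ xs) with P? x | Q? x
  ... | yes p | yes q = contradiction q (disjoint x p)
  ... | yes _ | no  _ = cong suc (count-⊎ P? Q? disjoint xs)
  ... | no  _ | yes _ = trans (cong suc (count-⊎ P? Q? disjoint xs)) (sym (+-suc _ _))
  ... | no  _ | no  _ = count-⊎ P? Q? disjoint xs

  count-++ : {P : Pred A 0ℓ} (P? : Decidable P) (xs ys : List A) →
             count P? (xs ++ ys) ≡ count P? xs + count P? ys
  count-++ P? xs ys = trans (cong length (filter-++ P? xs ys)) (length-++ (filter P? xs))

count-map : {A B : Set} {P : Pred B 0ℓ} (P? : Decidable P) (f : A → B) (xs : List A) →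
            count P? (map f xs) ≡ count (P? ∘ f) xs
count-map P? f []       = refl
count-map P? f (x ∷ xs) with P? (f x)
... | yes _ = cong suc (count-map P? f xs)
... | no  _ = count-map P? f xs

count-concatMap : ∀ {N} {A B : Set} {P : Pred B 0ℓ} (P? : Decidable P)
                  {R : Pred A 0ℓ} (R? : Decidable R) (a : Fin N) (E : Fin N → A → B) →
                  (∀ b x → P (E b x) → b ≡ a × R x) → (∀ x → R x → P (E a x)) →
                  (xs : List A) (bs : List (Fin N)) →
                  count P? (concatMap (λ b → map (E b) xs) bs) ≡ count (Fin._≟ a) bs * count R? xs
count-concatMap P? R? a E sound complete xs []       = refl
count-concatMap P? R? a E sound complete xs (b ∷ bs) with b Fin.≟ a
... | yes refl = begin
  count P? (map (E a) xs ++ rest)        ≡⟨ count-++ P? (map (E a) xs) rest ⟩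
  count P? (map (E a) xs) + count P? rest ≡⟨ cong₂ _+_ pulled (count-concatMap P? R? a E sound complete xs bs) ⟩
  count R? xs + count (Fin._≟ a) bs * count R? xs ∎
  where
  open ≡-Reasoning
  rest = concatMap (λ b → map (E b) xs) bs
  pulled : count P? (map (E a) xs) ≡ count R? xs
  pulled = trans (count-map P? (E a) xs)
                 (count-≐ (P? ∘ E a) R? ((λ p → proj₂ (sound a _ p)) , complete _) xs)
... | no b≢a = trans (count-++ P? (map (E b) xs) _)
                     (cong₂ _+_ (trans (count-map P? (E b) xs)
                                       (count-none (P? ∘ E b) (λ x p → b≢a (proj₁ (sound b x p))) xs))
                                (count-concatMap P? R? a E sound complete xs bs))

below? : ∀ {n} (k : ℕ) → Decidable (λ (y : Fin n) → toℕ y < k)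
below? k y = toℕ y <? k

count-below : ∀ {n k} → k ≤ n → count (below? {n} k) (allFin n) ≡ k
count-below {n} {zero} _ = count-none (below? {n} 0) (λ _ ()) (allFin n)
count-below {suc n} {suc k} (s≤s k≤n) = cong suc (begin
  count below-1+k (tabulate fsuc)                 ≡⟨ cong (count below-1+k) (map-tabulate id fsuc) ⟨
  count below-1+k (map fsuc (allFin n))           ≡⟨ count-map below-1+k fsuc (allFin n) ⟩
  count (below-1+k ∘ fsuc) (allFin n)             ≡⟨ count-≐ (below-1+k ∘ fsuc) (below? k) (s≤s⁻¹ , s≤s) (allFin n) ⟩
  count (below? k) (allFin n)                     ≡⟨ count-below k≤n ⟩
  k                                               ∎)
  where
  open ≡-Reasoning
  below-1+k = below? {suc n} (suc k)

inInterval? : ∀ {n} (lo hi : ℕ) → Decidable (λ (y : Fin n) → lo ≤ toℕ y × toℕ y ≤ hi)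
inInterval? lo hi y = (lo ≤? toℕ y) ×-dec (toℕ y ≤? hi)

-- A nonempty interval [lo, hi] inside Fin n has suc (hi ∸ lo) elements:
-- lying below suc hi means lying below lo or inside the interval.
count-interval : ∀ {n lo hi} → lo ≤ hi → hi < n →
                 count (inInterval? {n} lo hi) (allFin n) ≡ suc (hi ∸ lo)
count-interval {n} {lo} {hi} lo≤hi hi<n = begin
  count I? (allFin n)                                   ≡⟨ m+n∸m≡n lo _ ⟨
  lo + count I? (allFin n) ∸ lo                         ≡⟨ cong (λ c → c + count I? (allFin n) ∸ lo) (count-below lo≤n) ⟨
  count (below? lo) (allFin n) + count I? (allFin n) ∸ lo ≡⟨ cong (_∸ lo) (count-⊎ (below? lo) I? disjoint (allFin n)) ⟨
  count (λ y → below? lo y ⊎-dec I? y) (allFin n) ∸ lo  ≡⟨ cong (_∸ lo) (count-≐ _ (below? (suc hi)) (split , join) (allFin n)) ⟩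
  count (below? (suc hi)) (allFin n) ∸ lo               ≡⟨ cong (_∸ lo) (count-below hi<n) ⟩
  suc hi ∸ lo                                           ≡⟨ +-∸-assoc 1 lo≤hi ⟩
  suc (hi ∸ lo)                                         ∎
  where
  open ≡-Reasoning
  lo≤1+hi : lo ≤ suc hi
  lo≤1+hi = ≤-trans lo≤hi (n≤1+n hi)
  lo≤n : lo ≤ n
  lo≤n = ≤-trans lo≤1+hi hi<n
  I? = inInterval? {n} lo hi
  disjoint : ∀ (y : Fin n) → toℕ y < lo → ¬ (lo ≤ toℕ y × toℕ y ≤ hi)
  disjoint _ y<lo (lo≤y , _) = <⇒≱ y<lo lo≤y
  split : ∀ {y} → toℕ y < lo ⊎ (lo ≤ toℕ y × toℕ y ≤ hi) → toℕ y < suc hi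
  split (inj₁ y<lo)     = ≤-trans y<lo lo≤1+hi
  split (inj₂ (_ , y≤hi)) = s≤s y≤hi
  join : ∀ {y} → toℕ y < suc hi → toℕ y < lo ⊎ (lo ≤ toℕ y × toℕ y ≤ hi)
  join {y} y<1+hi with toℕ y <? lo
  ... | yes y<lo = inj₁ y<lo
  ... | no  y≮lo = inj₂ (≮⇒≥ y≮lo , s≤s⁻¹ y<1+hi)

count-point : ∀ {n} (a : Fin n) → count (Fin._≟ a) (allFin n) ≡ 1
count-point {n} a = begin
  count (Fin._≟ a) (allFin n)                     ≡⟨ count-≐ (Fin._≟ a) (inInterval? (toℕ a) (toℕ a)) (to , from) (allFin n) ⟩
  count (inInterval? (toℕ a) (toℕ a)) (allFin n) ≡⟨ count-interval ≤-refl (toℕ<n a) ⟩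
  suc (toℕ a ∸ toℕ a)                             ≡⟨ cong suc (n∸n≡0 (toℕ a)) ⟩
  1 ∎
  where
  open ≡-Reasoning
  to : ∀ {y} → y ≡ a → toℕ a ≤ toℕ y × toℕ y ≤ toℕ a
  to refl = ≤-refl , ≤-refl
  from : ∀ {y} → toℕ a ≤ toℕ y × toℕ y ≤ toℕ a → y ≡ a
  from (a≤y , y≤a) = toℕ-injective (≤-antisym y≤a a≤y)

StartsWith : ∀ {m N} → Fin N → Pred (Fin m → Fin N) 0ℓ → Pred (Fin (suc m) → Fin N) 0ℓ
StartsWith a R f = f fzero ≡ a × R (tail f)

-- Fixing the first value, a map is determined by its tail, so counting such
-- maps reduces to counting their tails.
count-startsWith : ∀ {m N} {P : Pred (Fin (suc m) → Fin N) 0ℓ} (P? : Decidable P)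
                   {R : Pred (Fin m → Fin N) 0ℓ} (R? : Decidable R) (a : Fin N) →
                   P ≐ StartsWith a R → count P? (allMaps (suc m) N) ≡ count R? (allMaps m N)
count-startsWith {m} {N} P? R? a (P⊆S , S⊆P) = begin
  count P? (allMaps (suc m) N)                          ≡⟨ count-concatMap P? R? a _ (λ _ _ → P⊆S) (λ _ r → S⊆P (refl , r)) (allMaps m N) (allFin N) ⟩
  count (Fin._≟ a) (allFin N) * count R? (allMaps m N) ≡⟨ cong (_* count R? (allMaps m N)) (count-point a) ⟩
  1 * count R? (allMaps m N)                            ≡⟨ *-identityˡ _ ⟩
  count R? (allMaps m N)                                ∎
  where open ≡-Reasoning

dist-comm : ∀ a b → dist a b ≡ dist b a
dist-comm a b = +-comm (a ∸ b) (b ∸ a)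

dist-ordered : ∀ {a b} → a ≤ b → dist a b ≡ b ∸ a
dist-ordered {a} {b} a≤b = cong (_+ (b ∸ a)) (m≤n⇒m∸n≡0 a≤b)

unit-step : ∀ a b → a ≤ b → dist a b ≤ 1 → b ≡ a ⊎ b ≡ suc a
unit-step zero    zero          _         _       = inj₁ refl
unit-step zero    (suc zero)    _         _       = inj₂ refl
unit-step zero    (suc (suc b)) _         (s≤s ())
unit-step (suc a) (suc b)       (s≤s a≤b) d with unit-step a b a≤b d
... | inj₁ b≡a  = inj₁ (cong suc b≡a)
... | inj₂ b≡1+a = inj₂ (cong suc b≡1+a)

-- Order properties of finite sequences of naturals v : Fin n → ℕ; for the
-- value sequence of a transformation they are exactly the paper's
-- order-preserving, order-reversing and contraction conditions.
Monotone : ∀ {n} → (Fin n → ℕ) → Set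
Monotone {n} v = (x y : Fin n) → toℕ x ≤ toℕ y → v x ≤ v y

Antitone : ∀ {n} → (Fin n → ℕ) → Set
Antitone {n} v = (x y : Fin n) → toℕ x ≤ toℕ y → v y ≤ v x

NonExpanding : ∀ {n} → (Fin n → ℕ) → Set
NonExpanding {n} v = (x y : Fin n) → dist (v x) (v y) ≤ dist (toℕ x) (toℕ y)

Spans : ∀ {n} → (Fin n → ℕ) → ℕ → ℕ → Set
Spans {n} v lo hi = (∀ i → lo ≤ v i × v i ≤ hi) × (∀ y → lo ≤ y → y ≤ hi → ∃ λ i → v i ≡ y)

-- Walk v s t: v starts at s, each step stays put or goes up by one, and it
-- ends at t.  Continues u s t: u carries on such a walk that has reached s.
Walk : ∀ {m} → (Fin (suc m) → ℕ) → ℕ → ℕ → Set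
Continues : ∀ {m} → (Fin m → ℕ) → ℕ → ℕ → Set

Walk v s t = v fzero ≡ s × Continues (tail v) s t

Continues {zero}  _ s t = s ≡ t
Continues {suc m} u s t = Walk u s t ⊎ Walk u (suc s) t

walk? : ∀ {m} (v : Fin (suc m) → ℕ) s t → Dec (Walk v s t)
continues? : ∀ {m} (u : Fin m → ℕ) s t → Dec (Continues u s t)

walk? v s t = (v fzero ≟ s) ×-dec continues? (tail v) s t

continues? {zero}  _ s t = s ≟ t
continues? {suc m} u s t = walk? u s t ⊎-dec walk? u (suc s) t

walk-tail : ∀ {m} (v : Fin (suc (suc m)) → ℕ) {s t} → Walk v s t →
            ∃ λ s′ → s ≤ s′ × s′ ≤ suc s × Walk (tail v) s′ t
walk-tail v {s} (_ , inj₁ w) = s , ≤-refl , n≤1+n s , w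
walk-tail v {s} (_ , inj₂ w) = suc s , n≤1+n s , ≤-refl , w

walk-≤ : ∀ {m} (v : Fin (suc m) → ℕ) {s t} → Walk v s t → s ≤ t
walk-≤ {zero}  v (_ , refl) = ≤-refl
walk-≤ {suc m} v w with walk-tail v w
... | _ , s≤s′ , _ , w′ = ≤-trans s≤s′ (walk-≤ (tail v) w′)

walk-upper : ∀ {m} (v : Fin (suc m) → ℕ) {s t} → Walk v s t → ∀ i → v i ≤ t
walk-upper {zero}  v (v0≡s , refl) fzero = ≤-reflexive v0≡s
walk-upper {suc m} v w fzero = ≤-trans (≤-reflexive (proj₁ w)) (walk-≤ v w)
walk-upper {suc m} v w (fsuc i) with walk-tail v w
... | _ , _ , _ , w′ = walk-upper (tail v) w′ i

walk-increment : ∀ {m} (v : Fin (suc m) → ℕ) {s t} → Walk v s t → ∀ i j → toℕ i ≤ toℕ j →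
                 v i ≤ v j × v j ≤ v i + (toℕ j ∸ toℕ i)
walk-increment {zero} _ _ fzero fzero _ = ≤-refl , m≤m+n _ 0
walk-increment {suc m} _ _ fzero fzero _ = ≤-refl , m≤m+n _ 0
walk-increment {suc m} v {s} w fzero (fsuc j) _ with walk-tail v w
... | s′ , s≤s′ , s′≤1+s , w′ with walk-increment (tail v) w′ fzero j z≤n
... | v1≤vj , vj≤v1+j = grow , bounded
  where
  open ≤-Reasoning
  v0≡s = proj₁ w
  v1≡s′ = proj₁ w′
  grow : v fzero ≤ v (fsuc j)
  grow = begin
    v fzero        ≡⟨ v0≡s ⟩
    s              ≤⟨ s≤s′ ⟩
    s′             ≡⟨ v1≡s′ ⟨
    v (fsuc fzero) ≤⟨ v1≤vj ⟩
    v (fsuc j)     ∎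
  bounded : v (fsuc j) ≤ v fzero + suc (toℕ j)
  bounded = begin
    v (fsuc j)                 ≤⟨ vj≤v1+j ⟩
    v (fsuc fzero) + toℕ j     ≡⟨ cong (_+ toℕ j) v1≡s′ ⟩
    s′ + toℕ j                 ≤⟨ +-monoˡ-≤ (toℕ j) s′≤1+s ⟩
    suc s + toℕ j              ≡⟨ +-suc s (toℕ j) ⟨
    s + suc (toℕ j)            ≡⟨ cong (_+ suc (toℕ j)) v0≡s ⟨
    v fzero + suc (toℕ j)      ∎
walk-increment {suc m} v w (fsuc i) (fsuc j) (s≤s i≤j) with walk-tail v w
... | _ , _ , _ , w′ = walk-increment (tail v) w′ i j i≤j

walk-onto : ∀ {m} (v : Fin (suc m) → ℕ) {s t} → Walk v s t →
            ∀ y → s ≤ y → y ≤ t → ∃ λ i → v i ≡ y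
walk-onto {zero}  v (v0≡s , refl) y s≤y y≤t = fzero , trans v0≡s (≤-antisym s≤y y≤t)
walk-onto {suc m} v {s} w y s≤y y≤t with y ≟ s
... | yes refl = fzero , proj₁ w
... | no  y≢s with walk-tail v w
... | _ , _ , s′≤1+s , w′ with walk-onto (tail v) w′ y (≤-trans s′≤1+s (≤∧≢⇒< s≤y (y≢s ∘ sym))) y≤t
... | i , vi≡y = fsuc i , vi≡y

walk-spans : ∀ {m} (v : Fin (suc m) → ℕ) {s t} → Walk v s t → Spans v s t
walk-spans v {s} w = (λ i → lower i , walk-upper v w i) , walk-onto v w
  where
  lower : ∀ i → s ≤ v i
  lower i = subst (_≤ v i) (proj₁ w) (proj₁ (walk-increment v w fzero i z≤n))

walk-monotone : ∀ {m} (v : Fin (suc m) → ℕ) {s t} → Walk v s t → Monotone v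
walk-monotone v w x y x≤y = proj₁ (walk-increment v w x y x≤y)

ordered⇒nonExpanding : ∀ {n} (v : Fin n → ℕ) →
  (∀ x y → toℕ x ≤ toℕ y → dist (v x) (v y) ≤ dist (toℕ x) (toℕ y)) → NonExpanding v
ordered⇒nonExpanding v ordered x y with ≤-total (toℕ x) (toℕ y)
... | inj₁ x≤y = ordered x y x≤y
... | inj₂ y≤x = subst₂ _≤_ (dist-comm (v y) (v x)) (dist-comm (toℕ y) (toℕ x)) (ordered y x y≤x)

walk-nonExpanding : ∀ {m} (v : Fin (suc m) → ℕ) {s t} → Walk v s t → NonExpanding v
walk-nonExpanding v w = ordered⇒nonExpanding v λ x y x≤y →
  let vx≤vy , vy≤vx+d = walk-increment v w x y x≤y in begin
    dist (v x) (v y)           ≡⟨ dist-ordered vx≤vy ⟩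
    v y ∸ v x                  ≤⟨ m≤n+o⇒m∸n≤o (v y) (v x) vy≤vx+d ⟩
    toℕ y ∸ toℕ x              ≡⟨ dist-ordered x≤y ⟨
    dist (toℕ x) (toℕ y)       ∎
  where open ≤-Reasoning

-- A monotone non-expanding sequence moves by steps of 0 or 1: it is a walk.
monotone⇒walk : ∀ {m} (v : Fin (suc m) → ℕ) → Monotone v → NonExpanding v →
                ∃ λ t → Walk v (v fzero) t
monotone⇒walk {zero}  v _ _ = v fzero , refl , refl
monotone⇒walk {suc m} v mono nonExp
  with monotone⇒walk (tail v) (λ x y x≤y → mono (fsuc x) (fsuc y) (s≤s x≤y)) (λ x y → nonExp (fsuc x) (fsuc y))
     | unit-step (v fzero) (v (fsuc fzero)) (mono fzero (fsuc fzero) z≤n) (nonExp fzero (fsuc fzero))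
... | t , w | inj₁ v1≡v0  = t , refl , inj₁ (subst (λ s → Walk (tail v) s t) v1≡v0 w)
... | t , w | inj₂ v1≡1+v0 = t , refl , inj₂ (subst (λ s → Walk (tail v) s t) v1≡1+v0 w)

-- The interval spanned by a nonempty sequence is nonempty and determined by
-- the sequence: its end points are attained values.
spans-≤ : ∀ {m} {v : Fin (suc m) → ℕ} {lo hi} → Spans v lo hi → lo ≤ hi
spans-≤ (bounds , _) = let lo≤v0 , v0≤hi = bounds fzero in ≤-trans lo≤v0 v0≤hi

spans-extremes : ∀ {m} {v : Fin (suc m) → ℕ} {lo hi lo′ hi′} →
                 Spans v lo hi → Spans v lo′ hi′ → lo ≤ lo′ × hi′ ≤ hi
spans-extremes (bounds , _) S′@(_ , onto′) =
  let lo′≤hi′ = spans-≤ S′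
      i , vi≡lo′ = onto′ _ ≤-refl lo′≤hi′
      j , vj≡hi′ = onto′ _ lo′≤hi′ ≤-refl
  in subst (_ ≤_) vi≡lo′ (proj₁ (bounds i)) , subst (_≤ _) vj≡hi′ (proj₂ (bounds j))

spans-unique : ∀ {m} {v : Fin (suc m) → ℕ} {lo hi lo′ hi′} →
               Spans v lo hi → Spans v lo′ hi′ → lo ≡ lo′ × hi ≡ hi′
spans-unique S S′ =
  ≤-antisym (proj₁ (spans-extremes S S′)) (proj₁ (spans-extremes S′ S)) ,
  ≤-antisym (proj₂ (spans-extremes S′ S)) (proj₂ (spans-extremes S S′))

walk⇒properties : ∀ {m} (v : Fin (suc m) → ℕ) {lo hi} → Walk v lo hi →
                  (Monotone v × NonExpanding v) × Spans v lo hi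
walk⇒properties v w = (walk-monotone v w , walk-nonExpanding v w) , walk-spans v w

properties⇒walk : ∀ {m} (v : Fin (suc m) → ℕ) {lo hi} → Monotone v → NonExpanding v →
                  Spans v lo hi → Walk v lo hi
properties⇒walk v mono nonExp S with monotone⇒walk v mono nonExp
... | t , w with spans-unique (walk-spans v w) S
... | v0≡lo , t≡hi = subst₂ (Walk v) v0≡lo t≡hi w

-- Mirroring a sequence bounded by c, i ↦ c ∸ v i, turns decreasing into
-- increasing and preserves distances; it reduces the order-reversing case
-- to the order-preserving one.
mirror : ∀ {n} → ℕ → (Fin n → ℕ) → Fin n → ℕ
mirror c v i = c ∸ v i

Bounded : ∀ {n} → (Fin n → ℕ) → ℕ → Set
Bounded v c = ∀ i → v i ≤ c

mirror-involutive : ∀ {n} {v : Fin n → ℕ} {c} → Bounded v c → ∀ i → mirror c (mirror c v) i ≡ v i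
mirror-involutive bounded i = m∸[m∸n]≡n (bounded i)

mirror-gap : ∀ {a b c} → a ≤ b → b ≤ c → (c ∸ a) ∸ (c ∸ b) ≡ b ∸ a
mirror-gap {zero}              _         b≤c       = m∸[m∸n]≡n b≤c
mirror-gap {suc a} {suc b} {suc c} (s≤s a≤b) (s≤s b≤c) = mirror-gap a≤b b≤c

mirror-dist : ∀ {a b c} → a ≤ c → b ≤ c → dist (c ∸ a) (c ∸ b) ≡ dist a b
mirror-dist {a} {b} {c} a≤c b≤c with ≤-total a b
... | inj₁ a≤b = begin
  dist (c ∸ a) (c ∸ b) ≡⟨ dist-comm (c ∸ a) (c ∸ b) ⟩
  dist (c ∸ b) (c ∸ a) ≡⟨ dist-ordered (∸-monoʳ-≤ c a≤b) ⟩
  (c ∸ a) ∸ (c ∸ b)    ≡⟨ mirror-gap a≤b b≤c ⟩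
  b ∸ a                ≡⟨ dist-ordered a≤b ⟨
  dist a b             ∎
  where open ≡-Reasoning
... | inj₂ b≤a = begin
  dist (c ∸ a) (c ∸ b) ≡⟨ dist-ordered (∸-monoʳ-≤ c b≤a) ⟩
  (c ∸ b) ∸ (c ∸ a)    ≡⟨ mirror-gap b≤a a≤c ⟩
  a ∸ b                ≡⟨ dist-ordered b≤a ⟨
  dist b a             ≡⟨ dist-comm b a ⟩
  dist a b             ∎
  where open ≡-Reasoning

antitone⇒mirror-monotone : ∀ {n} {v : Fin n → ℕ} c → Antitone v → Monotone (mirror c v)
antitone⇒mirror-monotone c anti x y x≤y = ∸-monoʳ-≤ c (anti x y x≤y)

mirror-monotone⇒antitone : ∀ {n} {v : Fin n → ℕ} {c} → Bounded v c → Monotone (mirror c v) → Antitone v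
mirror-monotone⇒antitone {c = c} bounded mono x y x≤y =
  subst₂ _≤_ (mirror-involutive bounded y) (mirror-involutive bounded x) (∸-monoʳ-≤ c (mono x y x≤y))

nonExpanding-mirror : ∀ {n} {v : Fin n → ℕ} {c} → Bounded v c →
                      NonExpanding v → NonExpanding (mirror c v)
nonExpanding-mirror bounded nonExp x y =
  subst (_≤ dist (toℕ x) (toℕ y)) (sym (mirror-dist (bounded x) (bounded y))) (nonExp x y)

mirror-nonExpanding : ∀ {n} {v : Fin n → ℕ} {c} → Bounded v c →
                      NonExpanding (mirror c v) → NonExpanding v
mirror-nonExpanding bounded nonExp x y =
  subst (_≤ dist (toℕ x) (toℕ y)) (mirror-dist (bounded x) (bounded y)) (nonExp x y)

spans-≗ : ∀ {n} {v w : Fin n → ℕ} {lo hi} → (∀ i → v i ≡ w i) → Spans v lo hi → Spans w lo hi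
spans-≗ v≗w (bounds , onto) =
  (λ i → subst (λ a → _ ≤ a × a ≤ _) (v≗w i) (bounds i)) ,
  (λ y lo≤y y≤hi → let i , vi≡y = onto y lo≤y y≤hi in i , trans (sym (v≗w i)) vi≡y)

spans-mirror : ∀ {m} {v : Fin (suc m) → ℕ} {lo hi c} → hi ≤ c → Spans v lo hi →
               Spans (mirror c v) (c ∸ hi) (c ∸ lo)
spans-mirror {v = v} {lo} {hi} {c} hi≤c S@(bounds , onto) = bounds′ , onto′
  where
  bounds′ : ∀ i → c ∸ hi ≤ c ∸ v i × c ∸ v i ≤ c ∸ lo
  bounds′ i = let lo≤vi , vi≤hi = bounds i in ∸-monoʳ-≤ c vi≤hi , ∸-monoʳ-≤ c lo≤vi
  onto′ : ∀ y → c ∸ hi ≤ y → y ≤ c ∸ lo → ∃ λ i → c ∸ v i ≡ y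
  onto′ y c-hi≤y y≤c-lo = i , trans (cong (c ∸_) vi≡c-y) (m∸[m∸n]≡n y≤c)
    where
    y≤c = ≤-trans y≤c-lo (m∸n≤m c lo)
    lo≤c-y : lo ≤ c ∸ y
    lo≤c-y = subst (_≤ c ∸ y) (m∸[m∸n]≡n (≤-trans (spans-≤ S) hi≤c)) (∸-monoʳ-≤ c y≤c-lo)
    c-y≤hi : c ∸ y ≤ hi
    c-y≤hi = subst (c ∸ y ≤_) (m∸[m∸n]≡n hi≤c) (∸-monoʳ-≤ c c-hi≤y)
    i = proj₁ (onto (c ∸ y) lo≤c-y c-y≤hi)
    vi≡c-y = proj₂ (onto (c ∸ y) lo≤c-y c-y≤hi)

spans-bounded : ∀ {m} {v : Fin (suc m) → ℕ} {lo hi c} → Bounded v c → Spans v lo hi → hi ≤ c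
spans-bounded bounded S@(_ , onto) =
  let i , vi≡hi = onto _ (spans-≤ S) ≤-refl in subst (_≤ _) vi≡hi (bounded i)

spans-unmirror : ∀ {m} {v : Fin (suc m) → ℕ} {lo hi c} → Bounded v c →
                 Spans (mirror c v) lo hi → Spans v (c ∸ hi) (c ∸ lo)
spans-unmirror {v = v} {c = c} bounded S =
  spans-≗ (mirror-involutive bounded) (spans-mirror (spans-bounded (λ i → m∸n≤m c (v i)) S) S)

values : ∀ {n} → Transf n → Fin n → ℕ
values α x = toℕ (α x)

values-bounded : ∀ {m} (α : Transf (suc m)) → Bounded (values α) m
values-bounded α x = toℕ≤pred[n] (α x)

spans⇒h : ∀ {m} {α : Transf (suc m)} {lo hi} → Spans (values α) lo hi → h α ≡ suc (hi ∸ lo)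
spans⇒h {m} {α} {lo} {hi} S@(bounds , onto) = begin
  count (inImage? α) (allFin (suc m))         ≡⟨ count-≐ (inImage? α) (inInterval? lo hi) (image⊆ , ⊆image) (allFin (suc m)) ⟩
  count (inInterval? lo hi) (allFin (suc m)) ≡⟨ count-interval (spans-≤ S) (s≤s (spans-bounded (values-bounded α) S)) ⟩
  suc (hi ∸ lo)                               ∎
  where
  open ≡-Reasoning
  image⊆ : ∀ {y} → InImage α y → lo ≤ toℕ y × toℕ y ≤ hi
  image⊆ (x , refl) = bounds x
  ⊆image : ∀ {y} → lo ≤ toℕ y × toℕ y ≤ hi → InImage α y
  ⊆image {y} (lo≤y , y≤hi) = let x , αx≡y = onto (toℕ y) lo≤y y≤hi in x , toℕ-injective αx≡y

spans⇒max : ∀ {m} {α : Transf (suc m)} {lo hi} → Spans (values α) lo hi → HasMaxImage α (suc hi)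
spans⇒max S@(bounds , onto) =
  (let x , αx≡hi = onto _ (spans-≤ S) ≤-refl in x , cong suc αx≡hi) , λ x → s≤s (proj₂ (bounds x))

max-unique : ∀ {n} {α : Transf n} {k k′} → HasMaxImage α k → HasMaxImage α k′ → k ≡ k′
max-unique ((x , αx≡k) , below-k) ((x′ , αx′≡k′) , below-k′) =
  ≤-antisym (subst (_≤ _) αx≡k (below-k′ x)) (subst (_≤ _) αx′≡k′ (below-k x′))

orct⇒spans : ∀ {m} (α : Transf (suc m)) → InORCT α → ∃₂ λ lo hi → Spans (values α) lo hi
orct⇒spans α (contr , inj₁ op) with monotone⇒walk (values α) op contr
... | t , w = _ , t , walk-spans (values α) w
orct⇒spans {m} α (contr , inj₂ or)
  with monotone⇒walk (mirror m (values α)) (antitone⇒mirror-monotone m or)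
                     (nonExpanding-mirror (values-bounded α) contr)
... | t , w = _ , _ , spans-unmirror (values-bounded α) (walk-spans (mirror m (values α)) w)

-- A map f : Fin (suc m) → Fin N is read through an
-- injective r : Fin N → ℕ whose values cover [0, t]; the walks from s to t
-- then number m C (t ∸ s): choose which of the m steps go up.

module CountWalks {N : ℕ} (r : Fin N → ℕ) (r-injective : ∀ {a b} → r a ≡ r b → a ≡ b)
                  {t : ℕ} (r-covers : ∀ y → y ≤ t → ∃ λ a → r a ≡ y) where

  read : ∀ {m} → (Fin m → Fin N) → Fin m → ℕ
  read f i = r (f i)

  count-walks : ∀ m {s} → s ≤ t →
                count (λ f → walk? (read f) s t) (allMaps (suc m) N) ≡ m C (t ∸ s)
  count-continues : ∀ m {s} → s ≤ t →
                    count (λ g → continues? (read g) s t) (allMaps m N) ≡ m C (t ∸ s)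

  -- A walk is a first value r⁻¹(s) followed by a continuation.
  count-walks m {s} s≤t = begin
    count (λ f → walk? (read f) s t) (allMaps (suc m) N)      ≡⟨ count-startsWith _ _ a ((λ {f} → split {f}) , λ {f} → join {f}) ⟩
    count (λ g → continues? (read g) s t) (allMaps m N)      ≡⟨ count-continues m s≤t ⟩
    m C (t ∸ s)                                              ∎
    where
    open ≡-Reasoning
    a = proj₁ (r-covers s s≤t)
    ra≡s = proj₂ (r-covers s s≤t)
    split : ∀ {f} → Walk (read f) s t → StartsWith a (λ g → Continues (read g) s t) f
    split (rf0≡s , c) = r-injective (trans rf0≡s (sym ra≡s)) , c
    join : ∀ {f} → StartsWith a (λ g → Continues (read g) s t) f → Walk (read f) s t
    join {f} (f0≡a , c) = trans (cong r f0≡a) ra≡s , c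

  -- With no steps left, the walk must already be at t.
  count-continues zero {s} s≤t with m≤n⇒m<n∨m≡n s≤t
  ... | inj₂ refl = trans (count-all (λ g → s ≟ s) (λ _ → refl) (allMaps zero N))
                          (cong (zero C_) (sym (n∸n≡0 s)))
  ... | inj₁ s<t  = trans (count-none (λ g → s ≟ t) (λ _ → <⇒≢ s<t) (allMaps zero N))
                          (cong (zero C_) (sym (+-∸-assoc 1 s<t)))
  -- Otherwise the next step stays at s or goes up to suc s (Pascal's rule).
  count-continues (suc m) {s} s≤t = begin
    count (λ g → stay? g ⊎-dec up? g) (allMaps (suc m) N)   ≡⟨ count-⊎ stay? up? disjoint (allMaps (suc m) N) ⟩
    count stay? (allMaps (suc m) N) + count up? (allMaps (suc m) N)
                                                             ≡⟨ cong (_+ count up? (allMaps (suc m) N)) (count-walks m s≤t) ⟩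
    m C (t ∸ s) + count up? (allMaps (suc m) N)             ≡⟨ pascal (m≤n⇒m<n∨m≡n s≤t) ⟩
    suc m C (t ∸ s)                                         ∎
    where
    open ≡-Reasoning
    stay? : Decidable (λ (g : Fin (suc m) → Fin N) → Walk (read g) s t)
    stay? g = walk? (read g) s t
    up? : Decidable (λ (g : Fin (suc m) → Fin N) → Walk (read g) (suc s) t)
    up? g = walk? (read g) (suc s) t
    disjoint : ∀ g → Walk (read g) s t → ¬ Walk (read g) (suc s) t
    disjoint g (rg0≡s , _) (rg0≡1+s , _) = 1+n≢n (trans (sym rg0≡1+s) rg0≡s)
    pascal : s < t ⊎ s ≡ t → m C (t ∸ s) + count up? (allMaps (suc m) N) ≡ suc m C (t ∸ s)
    pascal (inj₁ s<t) = begin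
      m C (t ∸ s) + count up? (allMaps (suc m) N) ≡⟨ cong (m C (t ∸ s) +_) (count-walks m s<t) ⟩
      m C (t ∸ s) + m C (t ∸ suc s)               ≡⟨ cong (λ d → m C d + m C (t ∸ suc s)) t∸s≡1+d ⟩
      m C suc (t ∸ suc s) + m C (t ∸ suc s)       ≡⟨ +-comm (m C suc (t ∸ suc s)) _ ⟩
      m C (t ∸ suc s) + m C suc (t ∸ suc s)       ≡⟨ nCk+nC[k+1]≡[n+1]C[k+1] m (t ∸ suc s) ⟩
      suc m C suc (t ∸ suc s)                     ≡⟨ cong (suc m C_) t∸s≡1+d ⟨
      suc m C (t ∸ s)                             ∎
      where t∸s≡1+d = +-∸-assoc 1 s<t
    pascal (inj₂ refl) = begin
      m C (s ∸ s) + count up? (allMaps (suc m) N) ≡⟨ cong (m C (s ∸ s) +_) (count-none up? (λ g w → <-irrefl refl (walk-≤ (read g) w)) (allMaps (suc m) N)) ⟩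
      m C (s ∸ s) + 0                             ≡⟨ cong (λ d → m C d + 0) (n∸n≡0 s) ⟩
      1                                           ≡⟨ cong (suc m C_) (n∸n≡0 s) ⟨
      suc m C (s ∸ s)                             ∎

counted⇒spans : ∀ {m p k} (α : Transf (suc m)) → Counted (suc m) (suc p) (suc k) α →
                InORCT α × Spans (values α) (k ∸ p) k
counted⇒spans {p = p} {k} α (orct , h≡1+p , max≡1+k) with orct⇒spans α orct
... | lo , hi , S = orct , subst₂ (Spans (values α)) lo≡k∸p hi≡k S
  where
  open ≡-Reasoning
  hi≡k : hi ≡ k
  hi≡k = suc-injective (max-unique (spans⇒max S) max≡1+k)
  lo≡k∸p : lo ≡ k ∸ p
  lo≡k∸p = begin
    lo             ≡⟨ m∸[m∸n]≡n (spans-≤ S) ⟨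
    hi ∸ (hi ∸ lo) ≡⟨ cong₂ _∸_ hi≡k (suc-injective (trans (sym (spans⇒h S)) h≡1+p)) ⟩
    k ∸ p          ∎

spans⇒counted : ∀ {m p k} (α : Transf (suc m)) → p ≤ k → InORCT α × Spans (values α) (k ∸ p) k →
                Counted (suc m) (suc p) (suc k) α
spans⇒counted α p≤k (orct , S) = orct , trans (spans⇒h S) (cong suc (m∸[m∸n]≡n p≤k)) , spans⇒max S

-- A contraction with image [lo, hi] either walks up from lo to hi, or (if
-- order-reversing) walks down from hi to lo, i.e. its mirror walks up.
UpOrDown : ∀ m → ℕ → ℕ → Pred (Transf (suc m)) 0ℓ
UpOrDown m lo hi α = Walk (values α) lo hi ⊎ Walk (mirror m (values α)) (m ∸ hi) (m ∸ lo)

upOrDown? : ∀ m lo hi → Decidable (UpOrDown m lo hi)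
upOrDown? m lo hi α = walk? (values α) lo hi ⊎-dec walk? (mirror m (values α)) (m ∸ hi) (m ∸ lo)

spans⇒upOrDown : ∀ {m lo hi} (α : Transf (suc m)) → hi ≤ m →
                 InORCT α × Spans (values α) lo hi → UpOrDown m lo hi α
spans⇒upOrDown α hi≤m ((contr , inj₁ op) , S) = inj₁ (properties⇒walk (values α) op contr S)
spans⇒upOrDown {m} α hi≤m ((contr , inj₂ or) , S) =
  inj₂ (properties⇒walk (mirror m (values α)) (antitone⇒mirror-monotone m or)
                        (nonExpanding-mirror (values-bounded α) contr) (spans-mirror hi≤m S))

upOrDown⇒spans : ∀ {m lo hi} (α : Transf (suc m)) → lo ≤ hi → hi ≤ m →
                 UpOrDown m lo hi α → InORCT α × Spans (values α) lo hi
upOrDown⇒spans α lo≤hi hi≤m (inj₁ up) =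
  let (mono , nonExp) , S = walk⇒properties (values α) up in (nonExp , inj₁ mono) , S
upOrDown⇒spans {m} α lo≤hi hi≤m (inj₂ down) =
  let (mono , nonExp) , S = walk⇒properties (mirror m (values α)) down
      bounded = values-bounded α
  in (mirror-nonExpanding bounded nonExp , inj₂ (mirror-monotone⇒antitone bounded mono)) ,
     subst₂ (Spans (values α)) (m∸[m∸n]≡n (≤-trans lo≤hi hi≤m)) (m∸[m∸n]≡n hi≤m) (spans-unmirror bounded S)

counted≐upOrDown : ∀ {m p k} → p ≤ k → k ≤ m → Counted (suc m) (suc p) (suc k) ≐ UpOrDown m (k ∸ p) k
counted≐upOrDown {p = p} {k} p≤k k≤m =
  (λ {α} counted → spans⇒upOrDown α k≤m (counted⇒spans α counted)) ,
  (λ {α} upOrDown → spans⇒counted α p≤k (upOrDown⇒spans α (m∸n≤m k p) k≤m upOrDown))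

-- For a nondegenerate image the two shapes exclude each other: they start
-- at different ends of the image …
up-down-disjoint : ∀ {m lo hi} (α : Transf (suc m)) → lo < hi → hi ≤ m →
                   Walk (values α) lo hi → ¬ Walk (mirror m (values α)) (m ∸ hi) (m ∸ lo)
up-down-disjoint α lo<hi hi≤m (α0≡lo , _) (m∸α0≡m∸hi , _) =
  <⇒≢ lo<hi (trans (sym α0≡lo) (∸-cancelˡ-≡ (values-bounded α fzero) hi≤m m∸α0≡m∸hi))

-- … while for a one-point image both describe the same constant map.
spans-point⇒monotone : ∀ {n} {v : Fin n → ℕ} {c} → Spans v c c → Monotone v
spans-point⇒monotone {v = v} {c} (bounds , _) x y _ = ≤-reflexive (trans (v≡c x) (sym (v≡c y)))
  where
  v≡c : ∀ i → v i ≡ c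
  v≡c i = ≤-antisym (proj₂ (bounds i)) (proj₁ (bounds i))

point-upOrDown⇒up : ∀ {m c} (α : Transf (suc m)) → c ≤ m → UpOrDown m c c α → Walk (values α) c c
point-upOrDown⇒up α c≤m upOrDown with upOrDown⇒spans α ≤-refl c≤m upOrDown
... | (nonExp , _) , S = properties⇒walk (values α) (spans-point⇒monotone S) nonExp S

count-up : ∀ {m lo hi} → lo ≤ hi → hi ≤ m →
           count (λ α → walk? (values α) lo hi) (allMaps (suc m) (suc m)) ≡ m C (hi ∸ lo)
count-up {m} {hi = hi} lo≤hi hi≤m = CountWalks.count-walks toℕ toℕ-injective covers m lo≤hi
  where
  covers : ∀ y → y ≤ hi → ∃ λ (a : Fin (suc m)) → toℕ a ≡ y
  covers y y≤hi = fromℕ< (s≤s (≤-trans y≤hi hi≤m)) , toℕ-fromℕ< _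

count-down : ∀ {m lo hi} → lo ≤ hi → hi ≤ m →
             count (λ α → walk? (mirror m (values α)) (m ∸ hi) (m ∸ lo)) (allMaps (suc m) (suc m)) ≡ m C (hi ∸ lo)
count-down {m} {lo} {hi} lo≤hi hi≤m =
  trans (CountWalks.count-walks reflect reflect-injective covers m (∸-monoʳ-≤ m lo≤hi))
        (cong (m C_) (mirror-gap lo≤hi hi≤m))
  where
  reflect : Fin (suc m) → ℕ
  reflect a = m ∸ toℕ a
  reflect-injective : ∀ {a b} → reflect a ≡ reflect b → a ≡ b
  reflect-injective {a} {b} eq = toℕ-injective (∸-cancelˡ-≡ (toℕ≤pred[n] a) (toℕ≤pred[n] b) eq)
  covers : ∀ y → y ≤ m ∸ lo → ∃ λ a → reflect a ≡ y
  covers y y≤m∸lo = fromℕ< m∸y<1+m ,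
                    trans (cong (m ∸_) (toℕ-fromℕ< m∸y<1+m)) (m∸[m∸n]≡n (≤-trans y≤m∸lo (m∸n≤m m lo)))
    where
    m∸y<1+m : m ∸ y < suc m
    m∸y<1+m = s≤s (m∸n≤m m y)

count-upOrDown : ∀ {m lo hi} → lo < hi → hi ≤ m →
                 count (upOrDown? m lo hi) (allMaps (suc m) (suc m)) ≡ 2 * (m C (hi ∸ lo))
count-upOrDown {m} {lo} {hi} lo<hi hi≤m = begin
  count (upOrDown? m lo hi) maps                                      ≡⟨ count-⊎ _ _ (λ α → up-down-disjoint α lo<hi hi≤m) maps ⟩
  count (λ α → walk? (values α) lo hi) maps +
  count (λ α → walk? (mirror m (values α)) (m ∸ hi) (m ∸ lo)) maps    ≡⟨ cong₂ _+_ (count-up lo≤hi hi≤m) (count-down lo≤hi hi≤m) ⟩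
  m C (hi ∸ lo) + m C (hi ∸ lo)                                       ≡⟨ cong (m C (hi ∸ lo) +_) (+-identityʳ _) ⟨
  2 * (m C (hi ∸ lo))                                                 ∎
  where
  open ≡-Reasoning
  maps = allMaps (suc m) (suc m)
  lo≤hi = <⇒≤ lo<hi

count-upOrDown-point : ∀ {m c} → c ≤ m → count (upOrDown? m c c) (allMaps (suc m) (suc m)) ≡ 1
count-upOrDown-point {m} {c} c≤m = begin
  count (upOrDown? m c c) maps              ≡⟨ count-≐ (upOrDown? m c c) (λ α → walk? (values α) c c)
                                                       ((λ {α} → point-upOrDown⇒up α c≤m) , inj₁) maps ⟩
  count (λ α → walk? (values α) c c) maps   ≡⟨ count-up ≤-refl c≤m ⟩
  m C (c ∸ c)                               ≡⟨ cong (m C_) (n∸n≡0 c) ⟩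
  1                                         ∎
  where
  open ≡-Reasoning
  maps = allMaps (suc m) (suc m)

proposition3p3 : (n p k : ℕ) → 1 ≤ n → 1 ≤ p → p ≤ k → k ≤ n →
    (1 < p → F n p k ≡ 2 * ((n ∸ 1) C (p ∸ 1))) × (p ≡ 1 → F n p k ≡ 1)
proposition3p3 (suc m) (suc p) (suc k) _ _ (s≤s p≤k) (s≤s k≤m) = two-shapes , one-shape
  where
  open ≡-Reasoning
  maps = allMaps (suc m) (suc m)
  F≡walks : F (suc m) (suc p) (suc k) ≡ count (upOrDown? m (k ∸ p) k) maps
  F≡walks = count-≐ (counted? _ _ _) (upOrDown? m (k ∸ p) k) (counted≐upOrDown p≤k k≤m) maps

  two-shapes : 1 < suc p → F (suc m) (suc p) (suc k) ≡ 2 * (m C p)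
  two-shapes (s≤s 0<p) = begin
    F (suc m) (suc p) (suc k)                   ≡⟨ F≡walks ⟩
    count (upOrDown? m (k ∸ p) k) maps          ≡⟨ count-upOrDown (∸-monoʳ-< 0<p p≤k) k≤m ⟩
    2 * (m C (k ∸ (k ∸ p)))                     ≡⟨ cong (λ d → 2 * (m C d)) (m∸[m∸n]≡n p≤k) ⟩
    2 * (m C p)                                 ∎

  one-shape : suc p ≡ 1 → F (suc m) (suc p) (suc k) ≡ 1
  one-shape refl = trans F≡walks (count-upOrDown-point k≤m)
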